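{- Let $m>1$ be an integer and let $h=2^{m-1}-1$. A position $M=(n_0,n_1,\dots,n_{2^m-1})$ of ${\rm ECN}((2^m)_{\{1,3,\dots,h\}},2^m-2)$ is a $\mathcal{P}$-position if and only if $n_0=n_2=\cdots=n_{2^m-2}$ and $n_1=n_3=\cdots=n_{2^m-1}$.
   Context: Extended circular nim ${\rm ECN}(N_S,k)$ (positive integers $k\le N$, $S$ a set of positive integers each at most $N/2$): there are $N$ piles $v_0,\dots,v_{N-1}$ arranged in a circle (indices mod $N$); a position is a tuple $(n_0,\dots,n_{N-1})$ of nonnegative integers, $n_i$ being the number of tokens on $v_i$. A move chooses $s\in S$, $i\in\{0,\dots,N-1\}$, $j\in\{0,\dots,k-1\}$ and removes an arbitrary nonnegative number of tokens from each pile $v_{(i+ts)\bmod N}$, $t=0,\dots,j$, removing at least one token in total (empty piles still count as piles). Normal play: the player unable to move loses. A $\mathcal{P}$-position is a position from which the previous player (the player who just moved) has a winning strategy. The set $\{1,3,\dots,h\}$ is the set of all odd integers from $1$ to $h$. -}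

module Defs where

open import Data.Nat using (ℕ; zero; suc; _+_; _*_; _∸_; _^_; _≤_; _<_)
open import Data.Nat.DivMod using (_%_)
open import Data.Fin using (Fin; toℕ)
open import Data.Product using (Σ; ∃; _×_; _,_)
open import Relation.Binary.PropositionalEquality using (_≡_)
open import Relation.Nullary using (¬_)

Position : ℕ → Set
Position N = Fin N → ℕ

-- Pile x is among v_{(i + t s) mod N}, t = 0,…,j  (congruence mod N, written
-- without division: x + c N = i + t s for some c).
Affected : (N s : ℕ) → Fin N → ℕ → Fin N → Set
Affected N s i j x = Σ ℕ λ t → t ≤ j × Σ ℕ λ c → toℕ x + c * N ≡ toℕ i + t * s

-- One move of ECN(N_S, k) from p to q: choose s ∈ S, i, j ∈ {0,…,k-1}, remove
-- any number of tokens from the affected piles, at least one token in total.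
record Move (N : ℕ) (S : ℕ → Set) (k : ℕ) (p q : Position N) : Set where
  field
    s        : ℕ
    s∈S      : S s
    i        : Fin N
    j        : ℕ
    j<k      : j < k
    le       : ∀ x → q x ≤ p x
    fixed    : ∀ x → ¬ Affected N s i j x → q x ≡ p x
    progress : Σ (Fin N) λ x → q x < p x

-- P-positions (previous player wins) and N-positions (next player wins),
-- defined inductively (the game is finite: total tokens strictly decrease).
mutual
  data IsP (N : ℕ) (S : ℕ → Set) (k : ℕ) (p : Position N) : Set where
    isP : (∀ q → Move N S k p q → IsN N S k q) → IsP N S k p

  data IsN (N : ℕ) (S : ℕ → Set) (k : ℕ) (p : Position N) : Set where
    isN : ∀ q → Move N S k p q → IsP N S k q → IsN N S k p

OddUpTo : ℕ → ℕ → Set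
OddUpTo h s = (s % 2 ≡ 1) × (1 ≤ s) × (s ≤ h)

{-# OPTIONS --safe #-}
-- Each step s ∈ S is a unit mod N, so the progression i, i + s, i + 2s, … (mod N) visits every pile
-- within its first N terms. A move only uses the terms of index at most N − 3, so the terms of index
-- N − 2 and N − 1 are untouched, and since s is odd they have opposite parities. Hence no move joins
-- two parity-constant positions: the pile that lost tokens has an untouched pile of its own parity.
-- From any other position, lower every pile to the minimum over its parity class. The two minimal
-- piles e and o are an odd distance d apart, d or N − d lies in S, and the progression with that step
-- ending in e and o makes the change in one move. So the parity-constant positions are a kernel of
-- the well-founded game graph, i.e. exactly the P-positions.
module Submission where

open import Defs
open import Data.Nat
  using (ℕ; zero; suc; _+_; _*_; _∸_; _^_; _≤_; _<_; z≤n; s≤s; pred; NonZero; _≟_; _<?_)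
open import Data.Nat.Properties
open import Data.Nat.DivMod
  using ( _%_; _/_; _mod_; m%n<n; m<n⇒m%n≡m; m%n%n≡m%n; %-distribˡ-+; %-remove-+ʳ; [m+n]%n≡m%n
        ; [m+kn]%n≡m%n; m≡m%n+[m/n]*n; m∣n⇒o%n%m≡o%m)
open import Data.Nat.Divisibility
  using (_∣_; _∤_; divides; ∣-trans; ∣1⇒≡1; ∣m+n∣m⇒∣n; m∣m*n; n∣m*n; >⇒∤; m%n≡0⇒n∣m; n∣m⇒m%n≡0)
open import Data.Nat.Coprimality using (Coprime; coprime-divisor) renaming (sym to coprime-sym)
open import Data.Nat.Primality using (irreducible[2])
open import Data.Nat.Induction using (<-wellFounded)
open import Data.Fin using (Fin; toℕ; punchOut)
open import Data.Fin.Properties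
  using (toℕ<n; toℕ-fromℕ<; toℕ-injective; injective⇒≤; punchOut-injective; any?; all?)
  renaming (_≟_ to _≟ᶠ_)
open import Data.List using (List; filter; allFin)
open import Data.List.Extrema.Nat using (argmin; argmin-all; f[argmin]≤f[xs])
open import Data.List.Membership.Propositional.Properties using (∈-filter⁺; ∈-allFin)
open import Data.List.Relation.Unary.All using (lookup)
open import Data.List.Relation.Unary.All.Properties using (all-filter)
open import Data.Product using (∃; _×_; _,_; proj₁; proj₂)
open import Data.Sum using (_⊎_; inj₁; inj₂; [_,_]′; swap)
open import Function using (_∘_; _on_)
open import Function.Bundles using (_⇔_; mk⇔)
open import Function.Definitions using (Injective)
open import Induction.WellFounded using (Acc; acc; WellFounded)
import Relation.Binary.Construct.On as On
open import Relation.Binary.PropositionalEquality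
  using (_≡_; _≢_; refl; sym; trans; cong; subst; ≢-sym; module ≡-Reasoning)
open import Relation.Binary.Definitions using (tri<; tri≈; tri>)
open import Relation.Nullary using (¬_; Dec; yes; no; contradiction)
open import Relation.Nullary.Decidable using (_→-dec_; decidable-stable)

open ≡-Reasoning

IsP⇒¬IsN : ∀ {N S k p} → IsP N S k p → ¬ IsN N S k p
IsP⇒¬IsN (isP answer) (isN q p→q q-isP) = IsP⇒¬IsN q-isP (answer q p→q)

tokens : ∀ {N} → Position N → ℕ
tokens {zero}  p = 0
tokens {suc N} p = p Fin.zero + tokens (p ∘ Fin.suc)

tokens-mono-≤ : ∀ {N} {p q : Position N} → (∀ x → q x ≤ p x) → tokens q ≤ tokens p
tokens-mono-≤ {zero}  q≤p = z≤n
tokens-mono-≤ {suc N} q≤p = +-mono-≤ (q≤p Fin.zero) (tokens-mono-≤ (q≤p ∘ Fin.suc))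

tokens-mono-< : ∀ {N} {p q : Position N} → (∀ x → q x ≤ p x) →
                ∀ x → q x < p x → tokens q < tokens p
tokens-mono-< q≤p Fin.zero    qx<px = +-mono-<-≤ qx<px (tokens-mono-≤ (q≤p ∘ Fin.suc))
tokens-mono-< q≤p (Fin.suc x) qx<px =
  +-mono-≤-< (q≤p Fin.zero) (tokens-mono-< (q≤p ∘ Fin.suc) x qx<px)

Move⇒tokens< : ∀ {N S k p q} → Move N S k p q → tokens q < tokens p
Move⇒tokens< mv = tokens-mono-< le (proj₁ progress) (proj₂ progress)
  where open Move mv

record IsKernel (N : ℕ) (S : ℕ → Set) (k : ℕ) (G : Position N → Set) : Set where
  field
    independent : ∀ {p q} → G p → G q → ¬ Move N S k p q
    absorbing   : ∀ {p} → ¬ G p → ∃ λ q → Move N S k p q × G q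

module _ {N S k} {G : Position N → Set} (kernel : IsKernel N S k G) where
  open IsKernel kernel

  private
    _≺_ : Position N → Position N → Set
    _≺_ = _<_ on tokens

  kernel⇒IsP : ∀ {p} → Acc _≺_ p → G p → IsP N S k p
  ∉kernel⇒IsN : ∀ {p} → Acc _≺_ p → ¬ G p → IsN N S k p

  kernel⇒IsP (acc smaller) p∈G =
    isP λ q p→q → ∉kernel⇒IsN (smaller (Move⇒tokens< p→q)) (λ q∈G → independent p∈G q∈G p→q)

  ∉kernel⇒IsN (acc smaller) p∉G =
    let (q , p→q , q∈G) = absorbing p∉G
    in isN q p→q (kernel⇒IsP (smaller (Move⇒tokens< p→q)) q∈G)

  IsP⇔kernel : (∀ p → Dec (G p)) → ∀ p → IsP N S k p ⇔ G p
  IsP⇔kernel G? p = mk⇔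
    (λ p-isP → decidable-stable (G? p) (IsP⇒¬IsN p-isP ∘ ∉kernel⇒IsN (wf p)))
    (kernel⇒IsP (wf p))
    where
      wf : WellFounded _≺_
      wf = On.wellFounded tokens <-wellFounded

even⊎odd : ∀ n → n % 2 ≡ 0 ⊎ n % 2 ≡ 1
even⊎odd n with n % 2 | m%n<n n 2
... | 0           | _               = inj₁ refl
... | 1           | _               = inj₂ refl
... | suc (suc _) | s≤s (s≤s ())

odd⇒2∤ : ∀ {n} → n % 2 ≡ 1 → 2 ∤ n
odd⇒2∤ {n} n-odd 2∣n = 0≢1+n (trans (sym (n∣m⇒m%n≡0 n 2 2∣n)) n-odd)

odd⇒>0 : ∀ {n} → n % 2 ≡ 1 → 0 < n
odd⇒>0 {suc n} _ = s≤s z≤n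

odd-difference : ∀ a d → (a + d) % 2 ≢ a % 2 → d % 2 ≡ 1
odd-difference a d a+d≁a with even⊎odd d
... | inj₁ d-even = contradiction (%-remove-+ʳ a (m%n≡0⇒n∣m d 2 d-even)) a+d≁a
... | inj₂ d-odd  = d-odd

%2-+ : ∀ a b {r r′} → a % 2 ≡ r → b % 2 ≡ r′ → (a + b) % 2 ≡ (r + r′) % 2
%2-+ a b refl refl = %-distribˡ-+ a b 2

odd-shift-%2 : ∀ {s} → s % 2 ≡ 1 → ∀ a c → a % 2 ≡ c % 2 ⊎ (a + s) % 2 ≡ c % 2
odd-shift-%2 s-odd a c with even⊎odd a | even⊎odd c
... | inj₁ a-even | inj₁ c-even = inj₁ (trans a-even (sym c-even))
... | inj₂ a-odd  | inj₂ c-odd  = inj₁ (trans a-odd (sym c-odd))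
... | inj₁ a-even | inj₂ c-odd  = inj₂ (trans (%2-+ a _ a-even s-odd) (sym c-odd))
... | inj₂ a-odd  | inj₁ c-even = inj₂ (trans (%2-+ a _ a-odd s-odd) (sym c-even))

<⇒≤∸1 : ∀ {m n} → m < n → m ≤ n ∸ 1
<⇒≤∸1 {n = suc n} (s≤s m≤n) = m≤n

<⇒pred[n]<n : ∀ {m n} → m < n → pred n < n
<⇒pred[n]<n {n = suc n} _ = ≤-refl

∣∧<⇒≡0 : ∀ {m n} → m ∣ n → n < m → n ≡ 0
∣∧<⇒≡0 {n = zero}  _   _   = refl
∣∧<⇒≡0 {n = suc _} m∣n n<m = contradiction m∣n (>⇒∤ n<m)

[m+n]%o≡m%o⇒o∣n : ∀ m n o .{{_ : NonZero o}} → (m + n) % o ≡ m % o → o ∣ n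
[m+n]%o≡m%o⇒o∣n m n o eq = ∣m+n∣m⇒∣n (divides ((m + n) / o) quotients) (n∣m*n (m / o))
  where
    quotients : m / o * o + n ≡ (m + n) / o * o
    quotients = +-cancelˡ-≡ (m % o) _ _ (begin
      m % o + (m / o * o + n)       ≡⟨ +-assoc (m % o) (m / o * o) n ⟨
      m % o + m / o * o + n         ≡⟨ cong (_+ n) (m≡m%n+[m/n]*n m o) ⟨
      m + n                         ≡⟨ m≡m%n+[m/n]*n (m + n) o ⟩
      (m + n) % o + (m + n) / o * o ≡⟨ cong (_+ (m + n) / o * o) eq ⟩
      m % o + (m + n) / o * o       ∎)

injective⇒surjective : ∀ {n} {f : Fin n → Fin n} → Injective _≡_ _≡_ f → ∀ y → ∃ λ x → f x ≡ y
injective⇒surjective {suc n} {f} f-injective y with any? (λ x → f x ≟ᶠ y)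
... | yes hit = hit
... | no miss = contradiction (injective⇒≤ punched-injective) 1+n≰n
  where
    y≢f : ∀ x → y ≢ f x
    y≢f x y≡fx = miss (x , sym y≡fx)
    punched : Fin (suc n) → Fin n
    punched x = punchOut (y≢f x)
    punched-injective : Injective _≡_ _≡_ punched
    punched-injective = f-injective ∘ punchOut-injective (y≢f _) (y≢f _)

∃-argmin : ∀ {n} {P : Fin n → Set} → (∀ x → Dec (P x)) → (f : Fin n → ℕ) →
           ∀ {x₀} → P x₀ → ∃ λ x → P x × (∀ {y} → P y → f x ≤ f y)
∃-argmin {n} P? f {x₀} Px₀ =
    argmin f x₀ candidates
  , argmin-all f Px₀ (all-filter P? (allFin n))
  , λ Py → lookup (f[argmin]≤f[xs] {f = f} x₀ candidates) (∈-filter⁺ P? (∈-allFin _) Py)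
  where
    candidates : List (Fin n)
    candidates = filter P? (allFin n)

module Progression (N : ℕ) .{{_ : NonZero N}} where

  progression : ℕ → ℕ → ℕ → ℕ
  progression s A t = (A + t * s) % N

  toℕ%N : (x : Fin N) → toℕ x % N ≡ toℕ x
  toℕ%N x = m<n⇒m%n≡m (toℕ<n x)

  toℕ-mod : ∀ n → toℕ (n mod N) ≡ n % N
  toℕ-mod n = toℕ-fromℕ< (m%n<n n N)

  progression-mod : ∀ s A t → progression s (A % N) t ≡ progression s A t
  progression-mod s A t = begin
    (A % N + t * s) % N           ≡⟨ %-distribˡ-+ (A % N) (t * s) N ⟩
    (A % N % N + t * s % N) % N   ≡⟨ cong (λ r → (r + t * s % N) % N) (m%n%n≡m%n A N) ⟩
    (A % N + t * s % N) % N       ≡⟨ %-distribˡ-+ A (t * s) N ⟨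
    (A + t * s) % N               ∎

  progression-shift : ∀ s A t u → progression s (A + t * s) u ≡ progression s A (t + u)
  progression-shift s A t u =
    cong (_% N) (trans (+-assoc A (t * s) (u * s)) (cong (A +_) (sym (*-distribʳ-+ s t u))))

  progression-injective-≤ : ∀ {s A t u} → Coprime s N → t ≤ u → u < N →
                            progression s A t ≡ progression s A u → t ≡ u
  progression-injective-≤ {s} {A} {t} {u} s⊥N t≤u u<N eq = begin
    t           ≡⟨ +-identityʳ t ⟨
    t + 0       ≡⟨ cong (t +_) gap≡0 ⟨
    t + (u ∸ t) ≡⟨ m+[n∸m]≡n t≤u ⟩
    u           ∎
    where
      gap : ℕ
      gap = u ∸ t
      u-split : A + u * s ≡ A + t * s + gap * s
      u-split = begin
        A + u * s               ≡⟨ cong (λ v → A + v * s) (m+[n∸m]≡n t≤u) ⟨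
        A + (t + gap) * s       ≡⟨ cong (A +_) (*-distribʳ-+ s t gap) ⟩
        A + (t * s + gap * s)   ≡⟨ +-assoc A (t * s) (gap * s) ⟨
        A + t * s + gap * s     ∎
      N∣gap*s : N ∣ gap * s
      N∣gap*s = [m+n]%o≡m%o⇒o∣n (A + t * s) (gap * s) N
                  (trans (cong (_% N) (sym u-split)) (sym eq))
      N∣gap : N ∣ gap
      N∣gap = coprime-divisor (coprime-sym s⊥N) (subst (N ∣_) (*-comm gap s) N∣gap*s)
      gap≡0 : gap ≡ 0
      gap≡0 = ∣∧<⇒≡0 N∣gap (≤-<-trans (m∸n≤m u t) u<N)

  progression-injective : ∀ {s A t u} → Coprime s N → t < N → u < N →
                          progression s A t ≡ progression s A u → t ≡ u
  progression-injective {t = t} {u} s⊥N t<N u<N eq with ≤-total t u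
  ... | inj₁ t≤u = progression-injective-≤ s⊥N t≤u u<N eq
  ... | inj₂ u≤t = sym (progression-injective-≤ s⊥N u≤t t<N (sym eq))

  progression-surjective : ∀ {s} → Coprime s N → ∀ A (y : Fin N) →
                           ∃ λ t → t < N × progression s A t ≡ toℕ y
  progression-surjective {s} s⊥N A y =
    let (t , hits) = injective⇒surjective term-injective y
    in toℕ t , toℕ<n t , trans (sym (toℕ-mod _)) (cong toℕ hits)
    where
      term : Fin N → Fin N
      term t = (A + toℕ t * s) mod N
      term-injective : Injective _≡_ _≡_ term
      term-injective {t} {u} eq = toℕ-injective (progression-injective s⊥N (toℕ<n t) (toℕ<n u)
        (trans (sym (toℕ-mod _)) (trans (cong toℕ eq) (toℕ-mod _))))

  affected⇒progression : ∀ {s i j x} → Affected N s i j x →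
                         ∃ λ t → t ≤ j × toℕ x ≡ progression s (toℕ i) t
  affected⇒progression {s} {i} {x = x} (t , t≤j , c , eq) = t , t≤j , (begin
    toℕ x                 ≡⟨ toℕ%N x ⟨
    toℕ x % N             ≡⟨ [m+kn]%n≡m%n (toℕ x) c N ⟨
    (toℕ x + c * N) % N   ≡⟨ cong (_% N) eq ⟩
    (toℕ i + t * s) % N   ∎)

  progression⇒affected : ∀ {s i j x t} → t ≤ j → toℕ x ≡ progression s (toℕ i) t →
                         Affected N s i j x
  progression⇒affected {s} {i} {t = t} t≤j eq =
    t , t≤j , (toℕ i + t * s) / N , trans (cong (_+ _) eq) (sym (m≡m%n+[m/n]*n (toℕ i + t * s) N))

  affected-index : ∀ {s i j u} → Coprime s N → j < N → u < N →
                   Affected N s i j ((toℕ i + u * s) mod N) → u ≤ j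
  affected-index {s} {i} {j} {u} s⊥N j<N u<N affected =
    let (t , t≤j , eq) = affected⇒progression affected
        t≡u = progression-injective s⊥N (≤-<-trans t≤j j<N) u<N (trans (sym eq) (toℕ-mod _))
    in subst (_≤ j) t≡u t≤j

ParityConstant : ∀ {N} → Position N → Set
ParityConstant {N} M = ∀ (x y : Fin N) → toℕ x % 2 ≡ toℕ y % 2 → M x ≡ M y

parityConstant? : ∀ {N} (M : Position N) → Dec (ParityConstant M)
parityConstant? M = all? λ x → all? λ y → (toℕ x % 2 ≟ toℕ y % 2) →-dec (M x ≟ M y)

byParity : ℕ → ℕ → ℕ → ℕ
byParity zero    m n = m
byParity (suc _) m n = n

module ParityGame {w : ℕ} {S : ℕ → Set}
  (N-even    : 2 ∣ 2 + w)
  (S-coprime : ∀ {s} → S s → Coprime s (2 + w))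
  (S-covers  : ∀ {d} → d < 2 + w → d % 2 ≡ 1 → S d ⊎ S (2 + w ∸ d))
  where

  N : ℕ
  N = 2 + w

  open Progression N

  S-odd : ∀ {s} → S s → s % 2 ≡ 1
  S-odd {s} s∈S with even⊎odd s
  ... | inj₂ s-odd  = s-odd
  ... | inj₁ s-even = contradiction (S-coprime s∈S (m%n≡0⇒n∣m s 2 s-even , N-even)) λ ()

  w<N : w < N
  w<N = n≤1+n (suc w)

  mod-parity : ∀ n → toℕ (n mod N) % 2 ≡ n % 2
  mod-parity n = trans (cong (_% 2) (toℕ-mod n)) (m∣n⇒o%n%m≡o%m 2 N n N-even)

  tail-unaffected : ∀ {s i j u} → S s → j < w → w ≤ u → u < N →
                    ¬ Affected N s i j ((toℕ i + u * s) mod N)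
  tail-unaffected s∈S j<w w≤u u<N affected =
    <⇒≱ (<-≤-trans j<w w≤u) (affected-index (S-coprime s∈S) (<-trans j<w w<N) u<N affected)

  tail-index-of-parity : ∀ {s} → S s → ∀ A c → ∃ λ u → w ≤ u × u < N × (A + u * s) % 2 ≡ c % 2
  tail-index-of-parity {s} s∈S A c with odd-shift-%2 (S-odd s∈S) (A + w * s) c
  ... | inj₁ same = w , ≤-refl , w<N , same
  ... | inj₂ same = suc w , n≤1+n w , ≤-refl , trans (cong (_% 2) shift) same
    where
      shift : A + suc w * s ≡ A + w * s + s
      shift = trans (cong (A +_) (+-comm s (w * s))) (sym (+-assoc A (w * s) s))

  unaffected-of-parity : ∀ {s i j} → S s → j < w → ∀ c →
                         ∃ λ y → ¬ Affected N s i j y × toℕ y % 2 ≡ c % 2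
  unaffected-of-parity {s} {i} s∈S j<w c =
    let (u , w≤u , u<N , parity) = tail-index-of-parity s∈S (toℕ i) c
    in   (toℕ i + u * s) mod N
       , tail-unaffected s∈S j<w w≤u u<N
       , trans (mod-parity (toℕ i + u * s)) parity

  independent : ∀ {p q} → ParityConstant p → ParityConstant q → ¬ Move N S w p q
  independent {p} {q} p-const q-const mv =
    let (x , qx<px) = progress
        (y , y-unaffected , y~x) = unaffected-of-parity s∈S j<k (toℕ x)
        x~y = sym y~x
        qx≡px = begin
          q x ≡⟨ q-const x y x~y ⟩
          q y ≡⟨ fixed y y-unaffected ⟩
          p y ≡⟨ p-const x y x~y ⟨
          p x ∎
    in <-irrefl qx≡px qx<px
    where open Move mv

  OneStepApart : ℕ → ℕ → Set
  OneStepApart a b = ∃ λ s → S s × ((a + s) % N ≡ b ⊎ (b + s) % N ≡ a)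

  odd-gap⇒one-step-apart : ∀ {a b} → a ≤ b → b < N → a % 2 ≢ b % 2 → OneStepApart a b
  odd-gap⇒one-step-apart {a} {b} a≤b b<N a≁b = [ forward , backward ]′ (S-covers gap<N gap-odd)
    where
      gap : ℕ
      gap = b ∸ a
      a+gap≡b : a + gap ≡ b
      a+gap≡b = m+[n∸m]≡n a≤b
      gap<N : gap < N
      gap<N = ≤-<-trans (m∸n≤m b a) b<N
      gap-odd : gap % 2 ≡ 1
      gap-odd = odd-difference a gap (λ eq → a≁b (trans (sym eq) (cong (_% 2) a+gap≡b)))
      forward : S gap → OneStepApart a b
      forward gap∈S = gap , gap∈S , inj₁ (trans (cong (_% N) a+gap≡b) (m<n⇒m%n≡m b<N))
      backward : S (N ∸ gap) → OneStepApart a b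
      backward N-gap∈S = N ∸ gap , N-gap∈S , inj₂ (begin
        (b + (N ∸ gap)) % N          ≡⟨ cong (λ v → (v + (N ∸ gap)) % N) a+gap≡b ⟨
        (a + gap + (N ∸ gap)) % N    ≡⟨ cong (_% N) (+-assoc a gap _) ⟩
        (a + (gap + (N ∸ gap))) % N  ≡⟨ cong (λ v → (a + v) % N) (m+[n∸m]≡n (<⇒≤ gap<N)) ⟩
        (a + N) % N                  ≡⟨ [m+n]%n≡m%n a N ⟩
        a % N                        ≡⟨ m<n⇒m%n≡m (≤-<-trans a≤b b<N) ⟩
        a                            ∎)

  one-step-apart : ∀ (a b : Fin N) → toℕ a % 2 ≢ toℕ b % 2 → OneStepApart (toℕ a) (toℕ b)
  one-step-apart a b a≁b with ≤-total (toℕ a) (toℕ b)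
  ... | inj₁ a≤b = odd-gap⇒one-step-apart a≤b (toℕ<n b) a≁b
  ... | inj₂ b≤a =
    let (s , s∈S , link) = odd-gap⇒one-step-apart b≤a (toℕ<n a) (≢-sym a≁b) in s , s∈S , swap link

  -- Started at a + 2s, the progression meets a and b = a + s at its last two indices w and w + 1.
  move-sparing : ∀ {p q s} {a b : Fin N} → S s → (toℕ a + s) % N ≡ toℕ b →
                 (∀ y → q y ≤ p y) → q a ≡ p a → q b ≡ p b → ∃ (λ x → q x < p x) →
                 Move N S w p q
  move-sparing {p} {q} {s} {a} {b} s∈S a+s≡b q≤p qa≡pa qb≡pb (x , qx<px) = record
    { s = s ; s∈S = s∈S ; i = i ; j = pred w ; j<k = <⇒pred[n]<n (proj₁ (proj₂ x-index))
    ; le = q≤p ; fixed = fixed ; progress = x , qx<px }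
    where
      i : Fin N
      i = (toℕ a + 2 * s) mod N
      from-a : ∀ t → progression s (toℕ i) t ≡ progression s (toℕ a) (2 + t)
      from-a t = begin
        progression s (toℕ i) t                ≡⟨ cong (λ r → progression s r t) (toℕ-mod (toℕ a + 2 * s)) ⟩
        progression s ((toℕ a + 2 * s) % N) t  ≡⟨ progression-mod s (toℕ a + 2 * s) t ⟩
        progression s (toℕ a + 2 * s) t        ≡⟨ progression-shift s (toℕ a) 2 t ⟩
        progression s (toℕ a) (2 + t)          ∎
      hits-a : progression s (toℕ i) w ≡ toℕ a
      hits-a = trans (from-a w) (trans (%-remove-+ʳ (toℕ a) (m∣m*n s)) (toℕ%N a))
      hits-b : progression s (toℕ i) (suc w) ≡ toℕ b
      hits-b = begin
        progression s (toℕ i) (suc w)  ≡⟨ from-a (suc w) ⟩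
        (toℕ a + (s + N * s)) % N      ≡⟨ cong (_% N) (+-assoc (toℕ a) s (N * s)) ⟨
        (toℕ a + s + N * s) % N        ≡⟨ %-remove-+ʳ (toℕ a + s) (m∣m*n s) ⟩
        (toℕ a + s) % N                ≡⟨ a+s≡b ⟩
        toℕ b                          ∎
      index : ∀ y → y ≢ a → y ≢ b → ∃ λ t → t < w × toℕ y ≡ progression s (toℕ i) t
      index y y≢a y≢b with progression-surjective (S-coprime s∈S) (toℕ i) y
      ... | t , t<N , hits with m≤n⇒m<n∨m≡n (≤-pred t<N)
      ...   | inj₂ refl = contradiction (toℕ-injective (trans (sym hits) hits-b)) y≢b
      ...   | inj₁ t<1+w with m≤n⇒m<n∨m≡n (≤-pred t<1+w)
      ...     | inj₂ refl = contradiction (toℕ-injective (trans (sym hits) hits-a)) y≢a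
      ...     | inj₁ t<w = t , t<w , sym hits
      x-index : ∃ λ t → t < w × toℕ x ≡ progression s (toℕ i) t
      x-index = index x (λ { refl → <-irrefl qa≡pa qx<px }) (λ { refl → <-irrefl qb≡pb qx<px })
      fixed : ∀ y → ¬ Affected N s i (pred w) y → q y ≡ p y
      fixed y unaffected with y ≟ᶠ a | y ≟ᶠ b
      ... | yes refl | _        = qa≡pa
      ... | no _     | yes refl = qb≡pb
      ... | no y≢a   | no y≢b   =
        let (t , t<w , y≡) = index y y≢a y≢b
        in contradiction (progression⇒affected (<⇒≤pred t<w) y≡) unaffected

  absorbing : ∀ {p} → ¬ ParityConstant p → ∃ λ q → Move N S w p q × ParityConstant q
  absorbing {p} p-varies
    with ∃-argmin (λ y → toℕ y % 2 ≟ 0) p {Fin.zero} refl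
       | ∃-argmin (λ y → toℕ y % 2 ≟ 1) p {Fin.suc Fin.zero} refl
  ... | e , e-even , e-min | o , o-odd , o-min = q , move , q-const
    where
      q : Position N
      q y = byParity (toℕ y % 2) (p e) (p o)
      q-at : ∀ y {r} → toℕ y % 2 ≡ r → q y ≡ byParity r (p e) (p o)
      q-at y = cong (λ r → byParity r (p e) (p o))
      q-const : ParityConstant q
      q-const x y = q-at x
      q≤p : ∀ y → q y ≤ p y
      q≤p y = [ (λ y-even → ≤-trans (≤-reflexive (q-at y y-even)) (e-min y-even))
              , (λ y-odd  → ≤-trans (≤-reflexive (q-at y y-odd)) (o-min y-odd))
              ]′ (even⊎odd (toℕ y))
      p-decreases : ∃ λ x → q x < p x
      p-decreases = decidable-stable (any? λ x → q x <? p x) λ none →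
        let q≡p : ∀ x → q x ≡ p x
            q≡p x = ≤-antisym (q≤p x) (≮⇒≥ λ qx<px → none (x , qx<px))
        in p-varies λ x y x~y → trans (sym (q≡p x)) (trans (q-const x y x~y) (q≡p y))
      move : Move N S w p q
      move with one-step-apart e o (λ e~o → 0≢1+n (trans (sym e-even) (trans e~o o-odd)))
      ... | s , s∈S , inj₁ e+s≡o = move-sparing s∈S e+s≡o q≤p (q-at e e-even) (q-at o o-odd) p-decreases
      ... | s , s∈S , inj₂ o+s≡e = move-sparing s∈S o+s≡e q≤p (q-at o o-odd) (q-at e e-even) p-decreases

  parityConstant-isKernel : IsKernel N S w ParityConstant
  parityConstant-isKernel = record { independent = independent ; absorbing = absorbing }

IsP⇔ParityConstant : ∀ {N S} → 2 ≤ N → 2 ∣ N → (∀ {s} → S s → Coprime s N) →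
                     (∀ {d} → d < N → d % 2 ≡ 1 → S d ⊎ S (N ∸ d)) →
                     (M : Position N) → IsP N S (N ∸ 2) M ⇔ ParityConstant M
IsP⇔ParityConstant (s≤s (s≤s z≤n)) N-even S-coprime S-covers =
  IsP⇔kernel (ParityGame.parityConstant-isKernel N-even S-coprime S-covers) parityConstant?

odd⇒coprime-2^ : ∀ {s} → s % 2 ≡ 1 → ∀ m → Coprime s (2 ^ m)
odd⇒coprime-2^ s-odd zero    (_ , i∣1) = ∣1⇒≡1 i∣1
odd⇒coprime-2^ {s} s-odd (suc m) {i} (i∣s , i∣2^[1+m]) =
  odd⇒coprime-2^ s-odd m (i∣s , coprime-divisor i⊥2 i∣2^[1+m])
  where
    i⊥2 : Coprime i 2
    i⊥2 {d} (d∣i , d∣2) with irreducible[2] d∣2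
    ... | inj₁ d≡1 = d≡1
    ... | inj₂ refl = contradiction (∣-trans d∣i i∣s) (odd⇒2∤ s-odd)

odd⇒OddUpTo-or-complement : ∀ {H d} → 2 ∣ H → d < 2 * H → d % 2 ≡ 1 →
                 OddUpTo (H ∸ 1) d ⊎ OddUpTo (H ∸ 1) (2 * H ∸ d)
odd⇒OddUpTo-or-complement {H} {d} H-even d<2H d-odd with <-cmp d H
... | tri< d<H _ _ = inj₁ (d-odd , odd⇒>0 d-odd , <⇒≤∸1 d<H)
... | tri≈ _ refl _ = contradiction H-even (odd⇒2∤ d-odd)
... | tri> _ _ H<d = inj₂ (rest-odd , odd⇒>0 rest-odd , <⇒≤∸1 rest<H)
  where
    d+rest≡2H : d + (2 * H ∸ d) ≡ 2 * H
    d+rest≡2H = m+[n∸m]≡n (<⇒≤ d<2H)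
    rest-odd : (2 * H ∸ d) % 2 ≡ 1
    rest-odd = odd-difference d (2 * H ∸ d) λ eq → 0≢1+n (begin
      0                      ≡⟨ n∣m⇒m%n≡0 (2 * H) 2 (m∣m*n H) ⟨
      2 * H % 2              ≡⟨ cong (_% 2) d+rest≡2H ⟨
      (d + (2 * H ∸ d)) % 2  ≡⟨ eq ⟩
      d % 2                  ≡⟨ d-odd ⟩
      1                      ∎)
    rest<H : 2 * H ∸ d < H
    rest<H = subst (2 * H ∸ d <_) (trans (m+n∸m≡n H (H + 0)) (+-identityʳ H))
                   (∸-monoʳ-< H<d (<⇒≤ d<2H))

mainTheorem15 : (m : ℕ) → 1 < m → (M : Position (2 ^ m)) →
    IsP (2 ^ m) (OddUpTo (2 ^ (m ∸ 1) ∸ 1)) (2 ^ m ∸ 2) M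
      ⇔ (∀ (x y : Fin (2 ^ m)) → toℕ x % 2 ≡ toℕ y % 2 → M x ≡ M y)
mainTheorem15 (suc zero) (s≤s ())
mainTheorem15 (suc (suc m)) _ =
  IsP⇔ParityConstant 2≤N (m∣m*n H)
    (λ s∈S → odd⇒coprime-2^ (proj₁ s∈S) (2 + m))
    (odd⇒OddUpTo-or-complement H-even)
  where
    H : ℕ
    H = 2 ^ suc m
    H-even : 2 ∣ H
    H-even = m∣m*n (2 ^ m)
    2≤N : 2 ≤ 2 * H
    2≤N = *-monoʳ-≤ 2 (m^n>0 2 (suc m))
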